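{- Let $k$ be a field, $G=\mathrm{GL}_n$ over $k$ with the stable generating subspace $W$ described below, and $V=\operatorname{Mat}_{n,n}(k)^r$ with $G$ acting by simultaneous conjugation. For $A=(A_1,\dots,A_r),B=(B_1,\dots,B_r)\in V$: $A$ and $B$ lie in the same $\mathrm{GL}_n(k)$-orbit if and only if $\{A\}$ and $\{B\}$ are isomorphic in $\mathcal C_3(V)$.
   Context: $R=k[G]$ is identified with the coordinate ring of $\{(C,D)\in\operatorname{Mat}_{n,n}\times\operatorname{Mat}_{n,n}: DC=I_n\}$ (so $C=g$, $D=g^{ -1}$), with comultiplication $\Delta$ (dual to multiplication), counit $\sigma_e$, antipode $\iota$. $W$ is the span of the constant function $1$ and the coordinate functions $c_{ij},d_{ij}$ (entries of $g$ and of $g^{ -1}$); $R_0=k$, $R_d=W^d$. The action on $V$ is a coassociative counital map $\mu:V\to V\otimes R$ and $\ell(V)$ (the least $\ell$ with $\mu(V)\subseteq V\otimes R_\ell$) equals $2$. $\mathcal C_3(V)$: for a subspace $S\subseteq R_3$, $(S)_3=\sum_{e\le3}(S\cap R_e)R_{3-e}$, $((S))_3$ = smallest subspace $J\supseteq S$ with $(J)_3=J$. Objects: affine subspaces of $V$ (incl. $\emptyset$). For nonempty $X_1=v_1+Z_1,X_2=v_2+Z_2$, $S(X_1,X_2)$ is the span of $(h\otimes\mathrm{id})\mu(w)-h(v_2)\cdot1$ with $h\in V^*$ vanishing on $Z_2$ and $w\in X_1$; $S(\emptyset,\cdot)=0$, $S(X,\emptyset)=k\cdot1$. $\operatorname{Hom}_3(X_1,X_2)=(R_3/((S(X_1,X_2)))_3)^*\subseteq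 R_3^*$, with composite of $\varphi:X_1\to X_2$ and $\psi:X_2\to X_3$ given by $r\mapsto(\psi\otimes\varphi)\Delta(r)$. -}

module Defs where

open import Level using (Level; _⊔_) renaming (suc to lsuc)
open import Algebra.Bundles using (CommutativeRing)
open import Data.Nat using (ℕ; zero; suc; _≤_; _∸_) renaming (_+_ to _+ℕ_; _⊔_ to _⊔ℕ_)
open import Data.Fin using (Fin)
open import Data.Fin.Properties using () renaming (_≟_ to _≟F_)
open import Data.List using (List; []; _∷_; _++_; map; concatMap)
open import Data.List.Base using () renaming (allFin to allFinL)
open import Data.Product using (Σ; ∃; _×_; _,_; proj₁; proj₂)
open import Relation.Nullary using (¬_; yes; no)
open import Relation.Binary.PropositionalEquality using (_≡_)

record Field (c ℓ : Level) : Set (lsuc (c Level.⊔ ℓ)) where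
  field
    commutativeRing : CommutativeRing c ℓ
  open CommutativeRing commutativeRing public
  field
    1≉0     : ¬ (1# ≈ 0#)
    inverse : ∀ x → ¬ (x ≈ 0#) → ∃ λ y → x * y ≈ 1#

module FieldDefs {c ℓ : Level} (K : Field c ℓ) where
  open Field K using (Carrier; _≈_; _+_; _*_; -_; 0#; 1#)

  sumK : ∀ {m} → (Fin m → Carrier) → Carrier
  sumK {zero}  f = 0#
  sumK {suc m} f = f Fin.zero + sumK (λ i → f (Fin.suc i))

  δ : ∀ {n} → Fin n → Fin n → Carrier
  δ i j with i ≟F j
  ... | yes _ = 1#
  ... | no  _ = 0#

  Mat : ℕ → Set c
  Mat n = Fin n → Fin n → Carrier

  _≈M_ : ∀ {n} → Mat n → Mat n → Set ℓ
  M ≈M N = ∀ i j → M i j ≈ N i j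

  _·M_ : ∀ {n} → Mat n → Mat n → Mat n
  (M ·M N) i j = sumK (λ m → M i m * N m j)

  Iₙ : ∀ {n} → Mat n
  Iₙ = δ

  SameOrbit : ∀ n r → (A B : Fin r → Mat n) → Set (c Level.⊔ ℓ)
  SameOrbit n r A B =
    Σ (Mat n) λ g → Σ (Mat n) λ g⁻¹ →
      ((g ·M g⁻¹) ≈M Iₙ) × ((g⁻¹ ·M g) ≈M Iₙ) ×
      (∀ l → ((g ·M A l) ·M g⁻¹) ≈M B l)

  -- R = k[G] = k[c_ij, d_ij] / (DC - I), presented by generators and
  -- relations: terms modulo the congruence generated by the axioms of
  -- commutative k-algebras and the relations (DC)_ij = δ_ij.

  infixl 6 _⊕_
  infixl 7 _⊗_

  data Term (n : ℕ) : Set c where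
    cst : Carrier → Term n
    cv  : Fin n → Fin n → Term n        -- c_ij (entries of g)
    dv  : Fin n → Fin n → Term n        -- d_ij (entries of g⁻¹)
    _⊕_ : Term n → Term n → Term n
    _⊗_ : Term n → Term n → Term n

  sumT : ∀ {n m} → (Fin m → Term n) → Term n
  sumT {m = zero}  f = cst 0#
  sumT {m = suc m} f = f Fin.zero ⊕ sumT (λ i → f (Fin.suc i))

  infix 4 _≈T_
  data _≈T_ {n : ℕ} : Term n → Term n → Set (c Level.⊔ ℓ) where
    reflT  : ∀ {x} → x ≈T x
    symT   : ∀ {x y} → x ≈T y → y ≈T x
    transT : ∀ {x y z} → x ≈T y → y ≈T z → x ≈T z
    ⊕-cong : ∀ {x x' y y'} → x ≈T x' → y ≈T y' → x ⊕ y ≈T x' ⊕ y'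
    ⊗-cong : ∀ {x x' y y'} → x ≈T x' → y ≈T y' → x ⊗ y ≈T x' ⊗ y'
    ⊕-assoc : ∀ x y z → (x ⊕ y) ⊕ z ≈T x ⊕ (y ⊕ z)
    ⊕-comm  : ∀ x y → x ⊕ y ≈T y ⊕ x
    ⊕-idˡ   : ∀ x → cst 0# ⊕ x ≈T x
    ⊕-invʳ  : ∀ x → x ⊕ cst (- 1#) ⊗ x ≈T cst 0#
    ⊗-assoc : ∀ x y z → (x ⊗ y) ⊗ z ≈T x ⊗ (y ⊗ z)
    ⊗-comm  : ∀ x y → x ⊗ y ≈T y ⊗ x
    ⊗-idˡ   : ∀ x → cst 1# ⊗ x ≈T x
    distribˡ : ∀ x y z → x ⊗ (y ⊕ z) ≈T x ⊗ y ⊕ x ⊗ z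
    cst-cong : ∀ {a b} → a ≈ b → cst a ≈T cst b
    cst-+    : ∀ a b → cst (a + b) ≈T cst a ⊕ cst b
    cst-*    : ∀ a b → cst (a * b) ≈T cst a ⊗ cst b
    DC≡I     : ∀ i j → sumT (λ m → dv i m ⊗ cv m j) ≈T cst (δ i j)

  -- filtration: R_d = W^d = classes of terms of degree ≤ d
  deg : ∀ {n} → Term n → ℕ
  deg (cst _)  = 0
  deg (cv _ _) = 1
  deg (dv _ _) = 1
  deg (s ⊕ t)  = deg s ⊔ℕ deg t
  deg (s ⊗ t)  = deg s +ℕ deg t

  InR : ∀ {n} → ℕ → Term n → Set (c Level.⊔ ℓ)
  InR d t = Σ _ λ t' → deg t' ≤ d × t' ≈T t

  -- comultiplication Δ(c_ij) = Σ_m c_im ⊗ c_mj, Δ(d_ij) = Σ_m d_mj ⊗ d_im,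
  -- extended multiplicatively; a tensor is a list of pure tensors (a , b) = a ⊗ b
  Δ : ∀ {n} → Term n → List (Term n × Term n)
  Δ {n} (cst a)  = (cst a , cst 1#) ∷ []
  Δ {n} (cv i j) = map (λ m → (cv i m , cv m j)) (allFinL n)
  Δ {n} (dv i j) = map (λ m → (dv m j , dv i m)) (allFinL n)
  Δ (s ⊕ t) = Δ s ++ Δ t
  Δ (s ⊗ t) = concatMap (λ p → map (λ q → (proj₁ p ⊗ proj₁ q , proj₂ p ⊗ proj₂ q)) (Δ t)) (Δ s)

  σₑ : ∀ {n} → Term n → Carrier
  σₑ (cst a)  = a
  σₑ (cv i j) = δ i j
  σₑ (dv i j) = δ i j
  σₑ (s ⊕ t)  = σₑ s + σₑ t
  σₑ (s ⊗ t)  = σₑ s * σₑ t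

  -- R_3^* : linear functionals on R_3 (given on representatives of degree ≤ 3)

  record Functional (n : ℕ) : Set (c Level.⊔ ℓ) where
    field
      app      : Term n → Carrier
      resp     : ∀ {s t} → deg s ≤ 3 → deg t ≤ 3 → s ≈T t → app s ≈ app t
      additive : ∀ {s t} → deg s ≤ 3 → deg t ≤ 3 → app (s ⊕ t) ≈ app s + app t
      homog    : ∀ a {t} → deg t ≤ 3 → app (cst a ⊗ t) ≈ a * app t
  open Functional public

  sumL : List Carrier → Carrier
  sumL []       = 0#
  sumL (x ∷ xs) = x + sumL xs

  -- composite of φ : X₁ → X₂ and ψ : X₂ → X₃ : r ↦ (ψ ⊗ φ) Δ(r)
  compose : ∀ {n} → Functional n → Functional n → Term n → Carrier
  compose ψ φ r = sumL (map (λ p → app ψ (proj₁ p) * app φ (proj₂ p)) (Δ r))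

  -- S({A},{B}) : span of (h ⊗ id) μ(A) - h(B)·1, h ∈ V^* (Z₂ = 0),
  -- with μ the coaction of simultaneous conjugation g·A = (g A_l g⁻¹)_l

  conjT : ∀ {n} → Mat n → Fin n → Fin n → Term n
  conjT M i j = sumT (λ p → sumT (λ q → cv i p ⊗ (cst (M p q) ⊗ dv q j)))

  module _ {n r : ℕ} where
    -- h ∈ V^* given by its coefficients h(v) = Σ h_lij v_lij
    evalDual : (Fin r → Mat n) → (Fin r → Mat n) → Carrier
    evalDual h v = sumK (λ l → sumK (λ i → sumK (λ j → h l i j * v l i j)))

    SGen : (A B : Fin r → Mat n) → (Fin r → Mat n) → Term n
    SGen A B h =
      sumT (λ l → sumT (λ i → sumT (λ j → cst (h l i j) ⊗ conjT (A l) i j)))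
      ⊕ cst (- evalDual h B)

    IsSGen : (A B : Fin r → Mat n) → Term n → Set (c Level.⊔ ℓ)
    IsSGen A B t = Σ (Fin r → Mat n) λ h → SGen A B h ≈T t

  -- ((S))_3 : smallest subspace J ⊇ S of R_3 with (J)_3 = J, where
  -- (J)_3 = Σ_{e ≤ 3} (J ∩ R_e) R_{3-e}
  data Closure3 {n : ℕ} (G : Term n → Set (c Level.⊔ ℓ)) : Term n → Set (c Level.⊔ ℓ) where
    gen   : ∀ {t} → G t → Closure3 G t
    zeroCl : Closure3 G (cst 0#)
    add   : ∀ {s t} → Closure3 G s → Closure3 G t → Closure3 G (s ⊕ t)
    scale : ∀ a {t} → Closure3 G t → Closure3 G (cst a ⊗ t)
    respCl : ∀ {s t} → Closure3 G s → s ≈T t → Closure3 G t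
    mul   : ∀ e {s q} → e ≤ 3 → InR e s → Closure3 G s → InR (3 ∸ e) q →
            Closure3 G (s ⊗ q)

  -- Hom_3({A},{B}) = (R_3 / ((S({A},{B})))_3)^*
  Hom3 : ∀ {n r} → (A B : Fin r → Mat n) → Functional n → Set (c Level.⊔ ℓ)
  Hom3 A B φ = ∀ t → deg t ≤ 3 → Closure3 (IsSGen A B) t → app φ t ≈ 0#

  -- {A} ≅ {B} in C_3(V); the identity of an object is the counit σ_e
  IsoC3 : ∀ n r → (A B : Fin r → Mat n) → Set (c Level.⊔ ℓ)
  IsoC3 n r A B =
    Σ (Functional n) λ φ → Σ (Functional n) λ ψ →
      Hom3 A B φ × Hom3 B A ψ ×
      (∀ t → deg t ≤ 3 → compose ψ φ t ≈ σₑ t) ×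
      (∀ t → deg t ≤ 3 → compose φ ψ t ≈ σₑ t)

-- If g A_l g⁻¹ = B_l, the evaluation characters of k[G] at g and at g⁻¹
-- are mutually inverse morphisms between {A} and {B}: they kill
-- S({A},{B}) and S({B},{A}), hence, being multiplicative, the closures
-- ((S))₃; and since Δ is dual to matrix multiplication, their composites
-- are evaluation at g⁻¹g = 1, which is the counit.
-- Conversely, given φ : {A} → {B} with inverse ψ, put g_ij = φ(c_ij) and
-- g'_ij = ψ(c_ij); the composites evaluated at c_ij give g g' = g' g = 1.
-- Moreover φ kills the degree-3 elements Σ_j ((c A_l d)_ij − (B_l)_ij) c_jk
-- of ((S))₃, and the relation DC = I collapses Σ_j (c A_l d)_ij c_jk to
-- (c A_l)_ik, so g A_l = B_l g.
module Submission where

open import Defs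
open import Level using (Level)
open import Data.Nat using (ℕ)
open import Data.Fin using (Fin)
open import Function.Bundles using (_⇔_)

open import Data.Nat using (zero; suc; _≤_; z≤n; s≤s)
open import Data.Nat.Properties using (≤-refl; ≤-trans; ⊔-lub; +-mono-≤)
open import Data.Fin using (zero; suc)
open import Data.Fin.Properties using (suc-injective) renaming (_≟_ to _≟F_)
open import Data.List using ([]; _∷_; _++_; map; concatMap; tabulate; allFin)
open import Data.List.Properties using (map-tabulate)
open import Data.Product using (_×_; _,_)
open import Data.Empty using (⊥-elim)
open import Function.Base using (_∘_)
open import Function.Bundles using (mk⇔)
open import Relation.Nullary using (Dec; yes; no)
open import Relation.Binary.Bundles using (Setoid)
open import Relation.Binary.PropositionalEquality as P using (_≡_; _≢_)
import Relation.Binary.Reasoning.Setoid as SetoidReasoning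
import Algebra.Properties.Group as GroupProperties
import Algebra.Properties.Ring as RingProperties
import Algebra.Properties.CommutativeSemigroup as CommutativeSemigroupProperties
import Algebra.Properties.Semiring.Sum as SemiringSum
import Data.Vec.Functional.Relation.Binary.Pointwise.Properties as Pointwise

module _ {c ℓ : Level} (K : Field c ℓ) where
  open Field K hiding (zero)
  open FieldDefs K renaming (distribˡ to ⊗-distribˡ-⊕)
  open SemiringSum semiring
    using ( sum; sum-cong-≋; sum-cong-≗; sum-replicate-zero
          ; ∑-distrib-+; ∑-comm; *-distribˡ-sum; *-distribʳ-sum)
  open RingProperties ring using (-1*x≈-x; -‿distribˡ-*)
  open GroupProperties +-group using (x∙y⁻¹≈ε⇒x≈y)
  open CommutativeSemigroupProperties *-commutativeSemigroup using (interchange; x∙yz≈zx∙y)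
  module FiniteSums where
    open SetoidReasoning setoid

    sumK≡sum : ∀ {m} (f : Fin m → Carrier) → sumK f ≡ sum f
    sumK≡sum {zero}  f = P.refl
    sumK≡sum {suc m} f = P.cong (f zero +_) (sumK≡sum (f ∘ suc))

    sumK-cong : ∀ {m} {f g : Fin m → Carrier} → (∀ i → f i ≈ g i) → sumK f ≈ sumK g
    sumK-cong {f = f} {g} f≈g = begin
      sumK f ≡⟨ sumK≡sum f ⟩
      sum f  ≈⟨ sum-cong-≋ f≈g ⟩
      sum g  ≡⟨ sumK≡sum g ⟨
      sumK g ∎

    sumK-0# : ∀ {m} → sumK {m} (λ _ → 0#) ≈ 0#
    sumK-0# {m} = trans (reflexive (sumK≡sum {m} (λ _ → 0#))) (sum-replicate-zero m)

    sumK-+ : ∀ {m} (f g : Fin m → Carrier) → sumK (λ i → f i + g i) ≈ sumK f + sumK g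
    sumK-+ f g = begin
      sumK (λ i → f i + g i) ≡⟨ sumK≡sum (λ i → f i + g i) ⟩
      sum (λ i → f i + g i)  ≈⟨ ∑-distrib-+ f g ⟩
      sum f + sum g          ≡⟨ P.cong₂ _+_ (sumK≡sum f) (sumK≡sum g) ⟨
      sumK f + sumK g        ∎

    sumK-comm : ∀ {m k} (f : Fin m → Fin k → Carrier) →
                sumK (λ i → sumK (λ j → f i j)) ≈ sumK (λ j → sumK (λ i → f i j))
    sumK-comm f = begin
      sumK (λ i → sumK (f i))           ≡⟨ sumK²≡sum² f ⟩
      sum (λ i → sum (f i))             ≈⟨ ∑-comm f ⟩
      sum (λ j → sum (λ i → f i j))     ≡⟨ sumK²≡sum² (λ j i → f i j) ⟨
      sumK (λ j → sumK (λ i → f i j))   ∎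
      where
      sumK²≡sum² : ∀ {m k} (f : Fin m → Fin k → Carrier) →
                   sumK (λ i → sumK (f i)) ≡ sum (λ i → sum (f i))
      sumK²≡sum² f = P.trans (sumK≡sum (λ i → sumK (f i))) (sum-cong-≗ (λ i → sumK≡sum (f i)))

    *-distribˡ-sumK : ∀ {m} a (f : Fin m → Carrier) → a * sumK f ≈ sumK (λ i → a * f i)
    *-distribˡ-sumK a f = begin
      a * sumK f            ≡⟨ P.cong (a *_) (sumK≡sum f) ⟩
      a * sum f             ≈⟨ *-distribˡ-sum a f ⟩
      sum (λ i → a * f i)   ≡⟨ sumK≡sum (λ i → a * f i) ⟨
      sumK (λ i → a * f i)  ∎

    *-distribʳ-sumK : ∀ {m} a (f : Fin m → Carrier) → sumK f * a ≈ sumK (λ i → f i * a)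
    *-distribʳ-sumK a f = begin
      sumK f * a            ≡⟨ P.cong (_* a) (sumK≡sum f) ⟩
      sum f * a             ≈⟨ *-distribʳ-sum a f ⟩
      sum (λ i → f i * a)   ≡⟨ sumK≡sum (λ i → f i * a) ⟨
      sumK (λ i → f i * a)  ∎

    -‿distrib-sumK : ∀ {m} (f : Fin m → Carrier) → - sumK f ≈ sumK (λ i → - f i)
    -‿distrib-sumK f = begin
      - sumK f                ≈⟨ -1*x≈-x (sumK f) ⟨
      - 1# * sumK f           ≈⟨ *-distribˡ-sumK (- 1#) f ⟩
      sumK (λ i → - 1# * f i) ≈⟨ sumK-cong (λ i → -1*x≈-x (f i)) ⟩
      sumK (λ i → - f i)      ∎

    δ-≡ : ∀ {m} (i j : Fin m) → i ≡ j → δ i j ≡ 1#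
    δ-≡ i j i≡j with i ≟F j
    ... | yes _   = P.refl
    ... | no  i≢j = ⊥-elim (i≢j i≡j)

    δ-≢ : ∀ {m} (i j : Fin m) → i ≢ j → δ i j ≡ 0#
    δ-≢ i j i≢j with i ≟F j
    ... | yes i≡j = ⊥-elim (i≢j i≡j)
    ... | no  _   = P.refl

    δ-sym : ∀ {m} (i j : Fin m) → δ i j ≡ δ j i
    δ-sym i j with i ≟F j
    ... | yes i≡j = P.sym (δ-≡ j i (P.sym i≡j))
    ... | no  i≢j = P.sym (δ-≢ j i (i≢j ∘ P.sym))

    δ-suc : ∀ {m} (i j : Fin m) → δ (suc i) (suc j) ≡ δ i j
    δ-suc i j = by-cases (i ≟F j)
      where
      by-cases : Dec (i ≡ j) → δ (suc i) (suc j) ≡ δ i j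
      by-cases (yes i≡j) = P.trans (δ-≡ (suc i) (suc j) (P.cong suc i≡j)) (P.sym (δ-≡ i j i≡j))
      by-cases (no  i≢j) = P.trans (δ-≢ (suc i) (suc j) (i≢j ∘ suc-injective)) (P.sym (δ-≢ i j i≢j))

    sumK-δ* : ∀ {m} (a : Fin m) (f : Fin m → Carrier) → sumK (λ i → δ a i * f i) ≈ f a
    sumK-δ* {suc m} zero f = begin
      δ {suc m} zero zero * f zero + sumK (λ i → δ zero (suc i) * f (suc i))
        ≈⟨ +-cong (*-congʳ (reflexive (δ-≡ {suc m} zero zero P.refl)))
                  (sumK-cong (λ i → trans (*-congʳ (reflexive (δ-≢ zero (suc i) λ ())))
                                          (zeroˡ (f (suc i))))) ⟩
      1# * f zero + sumK {m} (λ _ → 0#)  ≈⟨ +-cong (*-identityˡ (f zero)) (sumK-0# {m}) ⟩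
      f zero + 0#                         ≈⟨ +-identityʳ (f zero) ⟩
      f zero                              ∎
    sumK-δ* {suc m} (suc a) f = begin
      δ (suc a) zero * f zero + sumK (λ i → δ (suc a) (suc i) * f (suc i))
        ≈⟨ +-cong (trans (*-congʳ (reflexive (δ-≢ (suc a) zero λ ()))) (zeroˡ (f zero)))
                  (sumK-cong (λ i → *-congʳ (reflexive (δ-suc a i)))) ⟩
      0# + sumK (λ i → δ a i * f (suc i))  ≈⟨ +-identityˡ _ ⟩
      sumK (λ i → δ a i * f (suc i))       ≈⟨ sumK-δ* a (f ∘ suc) ⟩
      f (suc a)                            ∎

    sumK-*δ : ∀ {m} (a : Fin m) (f : Fin m → Carrier) → sumK (λ i → f i * δ i a) ≈ f a
    sumK-*δ a f = trans (sumK-cong (λ i → trans (*-comm (f i) (δ i a)) (*-congʳ (reflexive (δ-sym i a)))))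
                        (sumK-δ* a f)

    sumK²-δ* : ∀ {m k} (a : Fin m) (f : Fin m → Fin k → Carrier) →
               sumK (λ x → sumK (λ y → δ a x * f x y)) ≈ sumK (f a)
    sumK²-δ* a f = trans (sumK-cong (λ x → sym (*-distribˡ-sumK (δ a x) (f x))))
                         (sumK-δ* a (λ x → sumK (f x)))

    indicator : ∀ {n r} → Fin r → Fin n → Fin n → Fin r → Mat n
    indicator l i j l' i' j' = δ l l' * (δ i i' * δ j j')

    evalDual-indicator : ∀ {n r} (l : Fin r) (i j : Fin n) (F : Fin r → Mat n) →
                         evalDual (indicator l i j) F ≈ F l i j
    evalDual-indicator {n} {r} l i j F = begin
      sumK (λ l' → sumK (λ i' → sumK (λ j' → (δ l l' * (δ i i' * δ j j')) * F l' i' j')))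
        ≈⟨ sumK-cong {r} (λ l' → sumK-cong {n} (λ i' → trans (sumK-cong {n} (λ j' → *-assoc _ _ _))
                                                              (sym (*-distribˡ-sumK {n} (δ l l') _)))) ⟩
      sumK (λ l' → sumK (λ i' → δ l l' * sumK (λ j' → (δ i i' * δ j j') * F l' i' j')))
        ≈⟨ sumK²-δ* l (λ l' i' → sumK (λ j' → (δ i i' * δ j j') * F l' i' j')) ⟩
      sumK (λ i' → sumK (λ j' → (δ i i' * δ j j') * F l i' j'))
        ≈⟨ sumK-cong {n} (λ i' → sumK-cong {n} (λ j' → *-assoc _ _ _)) ⟩
      sumK (λ i' → sumK (λ j' → δ i i' * (δ j j' * F l i' j')))
        ≈⟨ sumK²-δ* i (λ i' j' → δ j j' * F l i' j') ⟩
      sumK (λ j' → δ j j' * F l i j')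
        ≈⟨ sumK-δ* j (F l i) ⟩
      F l i j ∎

    evalDual-cong : ∀ {n r} (h : Fin r → Mat n) {F G : Fin r → Mat n} →
                    (∀ l i j → F l i j ≈ G l i j) → evalDual h F ≈ evalDual h G
    evalDual-cong h F≈G = sumK-cong (λ l → sumK-cong (λ i → sumK-cong (λ j → *-congˡ (F≈G l i j))))

  open FiniteSums

  Mat-setoid : ℕ → Setoid c ℓ
  Mat-setoid n = Pointwise.setoid (Pointwise.setoid setoid n) n

  module Matrices {n : ℕ} where
    open SetoidReasoning (Mat-setoid n)
    open Setoid (Mat-setoid n) using () renaming (refl to ≈M-refl)

    ·M-cong : ∀ {M M' N N' : Mat n} → M ≈M M' → N ≈M N' → (M ·M N) ≈M (M' ·M N')
    ·M-cong M≈M' N≈N' i j = sumK-cong (λ m → *-cong (M≈M' i m) (N≈N' m j))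

    ·M-assoc : ∀ (M N O : Mat n) → ((M ·M N) ·M O) ≈M (M ·M (N ·M O))
    ·M-assoc M N O i j = K.begin
      sumK (λ m → sumK (λ p → M i p * N p m) * O m j)
        K.≈⟨ sumK-cong (λ m → *-distribʳ-sumK (O m j) (λ p → M i p * N p m)) ⟩
      sumK (λ m → sumK (λ p → M i p * N p m * O m j))
        K.≈⟨ sumK-comm (λ m p → M i p * N p m * O m j) ⟩
      sumK (λ p → sumK (λ m → M i p * N p m * O m j))
        K.≈⟨ sumK-cong (λ p → trans (sumK-cong (λ m → *-assoc (M i p) (N p m) (O m j)))
                                     (sym (*-distribˡ-sumK (M i p) (λ m → N p m * O m j)))) ⟩
      sumK (λ p → M i p * sumK (λ m → N p m * O m j)) K.∎
      where module K = SetoidReasoning setoid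

    ·M-identityˡ : ∀ (M : Mat n) → (Iₙ ·M M) ≈M M
    ·M-identityˡ M i j = sumK-δ* i (λ m → M m j)

    ·M-identityʳ : ∀ (M : Mat n) → (M ·M Iₙ) ≈M M
    ·M-identityʳ M i j = sumK-*δ j (M i)

    intertwining⇒conjugate : ∀ {g g' A B : Mat n} → (g ·M g') ≈M Iₙ →
                             (g ·M A) ≈M (B ·M g) → ((g ·M A) ·M g') ≈M B
    intertwining⇒conjugate {g} {g'} {A} {B} gg'≈I gA≈Bg = begin
      (g ·M A) ·M g'  ≈⟨ ·M-cong gA≈Bg (≈M-refl {g'}) ⟩
      (B ·M g) ·M g'  ≈⟨ ·M-assoc B g g' ⟩
      B ·M (g ·M g')  ≈⟨ ·M-cong (≈M-refl {B}) gg'≈I ⟩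
      B ·M Iₙ         ≈⟨ ·M-identityʳ B ⟩
      B               ∎

    conjugate⇒intertwining : ∀ {g g' A B : Mat n} → (g' ·M g) ≈M Iₙ →
                             ((g ·M A) ·M g') ≈M B → (g' ·M B) ≈M (A ·M g')
    conjugate⇒intertwining {g} {g'} {A} {B} g'g≈I gAg'≈B = begin
      g' ·M B                 ≈⟨ ·M-cong (≈M-refl {g'}) gAg'≈B ⟨
      g' ·M ((g ·M A) ·M g')  ≈⟨ ·M-assoc g' (g ·M A) g' ⟨
      (g' ·M (g ·M A)) ·M g'  ≈⟨ ·M-cong (·M-assoc g' g A) (≈M-refl {g'}) ⟨
      ((g' ·M g) ·M A) ·M g'  ≈⟨ ·M-cong (·M-cong g'g≈I (≈M-refl {A})) (≈M-refl {g'}) ⟩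
      (Iₙ ·M A) ·M g'         ≈⟨ ·M-cong (·M-identityˡ A) (≈M-refl {g'}) ⟩
      A ·M g'                 ∎

  open Matrices

  Term-setoid : ℕ → Setoid c (c Level.⊔ ℓ)
  Term-setoid n = record
    { Carrier       = Term n
    ; _≈_           = _≈T_
    ; isEquivalence = record { refl = reflT ; sym = symT ; trans = transT }
    }

  -- SGen A B h is definitionally evalDualT h (conjT ∘ A) ⊕ cst (- evalDual h B).
  evalDualT : ∀ {n r} → (Fin r → Mat n) → (Fin r → Fin n → Fin n → Term n) → Term n
  evalDualT h t = sumT (λ l → sumT (λ i → sumT (λ j → cst (h l i j) ⊗ t l i j)))

  module Terms {n : ℕ} where
    open SetoidReasoning (Term-setoid n)

    ⊗-distribʳ-⊕ : ∀ (x y z : Term n) → (x ⊕ y) ⊗ z ≈T x ⊗ z ⊕ y ⊗ z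
    ⊗-distribʳ-⊕ x y z = begin
      (x ⊕ y) ⊗ z      ≈⟨ ⊗-comm (x ⊕ y) z ⟩
      z ⊗ (x ⊕ y)      ≈⟨ ⊗-distribˡ-⊕ z x y ⟩
      z ⊗ x ⊕ z ⊗ y    ≈⟨ ⊕-cong (⊗-comm z x) (⊗-comm z y) ⟩
      x ⊗ z ⊕ y ⊗ z    ∎

    -- 0·x is additively idempotent, and hence zero.
    ⊗-zeroˡ : ∀ (x : Term n) → cst 0# ⊗ x ≈T cst 0#
    ⊗-zeroˡ x = begin
      y                          ≈⟨ ⊕-idˡ y ⟨
      cst 0# ⊕ y                 ≈⟨ ⊕-comm (cst 0#) y ⟩
      y ⊕ cst 0#                 ≈⟨ ⊕-cong reflT (⊕-invʳ y) ⟨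
      y ⊕ (y ⊕ cst (- 1#) ⊗ y)   ≈⟨ ⊕-assoc y y _ ⟨
      (y ⊕ y) ⊕ cst (- 1#) ⊗ y   ≈⟨ ⊕-cong y⊕y≈y reflT ⟩
      y ⊕ cst (- 1#) ⊗ y         ≈⟨ ⊕-invʳ y ⟩
      cst 0#                     ∎
      where
      y : Term n
      y = cst 0# ⊗ x
      y⊕y≈y : y ⊕ y ≈T y
      y⊕y≈y = begin
        y ⊕ y               ≈⟨ ⊗-distribʳ-⊕ (cst 0#) (cst 0#) x ⟨
        (cst 0# ⊕ cst 0#) ⊗ x ≈⟨ ⊗-cong (cst-+ 0# 0#) reflT ⟨
        cst (0# + 0#) ⊗ x   ≈⟨ ⊗-cong (cst-cong (+-identityˡ 0#)) reflT ⟩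
        y                   ∎

    sumT-cong : ∀ {m} {f g : Fin m → Term n} → (∀ i → f i ≈T g i) → sumT f ≈T sumT g
    sumT-cong {zero}  f≈g = reflT
    sumT-cong {suc m} f≈g = ⊕-cong (f≈g zero) (sumT-cong (f≈g ∘ suc))

    ⊗-distribʳ-sumT : ∀ {m} (f : Fin m → Term n) x → sumT f ⊗ x ≈T sumT (λ i → f i ⊗ x)
    ⊗-distribʳ-sumT {zero}  f x = ⊗-zeroˡ x
    ⊗-distribʳ-sumT {suc m} f x = begin
      (f zero ⊕ sumT (f ∘ suc)) ⊗ x          ≈⟨ ⊗-distribʳ-⊕ (f zero) (sumT (f ∘ suc)) x ⟩
      f zero ⊗ x ⊕ sumT (f ∘ suc) ⊗ x        ≈⟨ ⊕-cong reflT (⊗-distribʳ-sumT (f ∘ suc) x) ⟩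
      f zero ⊗ x ⊕ sumT (λ i → f (suc i) ⊗ x) ∎

    ⊗-distribˡ-sumT : ∀ {m} (f : Fin m → Term n) x → x ⊗ sumT f ≈T sumT (λ i → x ⊗ f i)
    ⊗-distribˡ-sumT f x = begin
      x ⊗ sumT f              ≈⟨ ⊗-comm x (sumT f) ⟩
      sumT f ⊗ x              ≈⟨ ⊗-distribʳ-sumT f x ⟩
      sumT (λ i → f i ⊗ x)    ≈⟨ sumT-cong (λ i → ⊗-comm (f i) x) ⟩
      sumT (λ i → x ⊗ f i)    ∎

    ⊗-distribʳ-evalDualT : ∀ {r} (h : Fin r → Mat n) t x →
                           evalDualT h t ⊗ x ≈T evalDualT h (λ l i j → t l i j ⊗ x)
    ⊗-distribʳ-evalDualT h t x =
      transT (⊗-distribʳ-sumT _ x) (sumT-cong λ l →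
      transT (⊗-distribʳ-sumT _ x) (sumT-cong λ i →
      transT (⊗-distribʳ-sumT _ x) (sumT-cong λ j →
      ⊗-assoc (cst (h l i j)) (t l i j) x)))

    deg-sumT : ∀ {m d} (f : Fin m → Term n) → (∀ i → deg (f i) ≤ d) → deg (sumT f) ≤ d
    deg-sumT {zero}  f deg≤ = z≤n
    deg-sumT {suc m} f deg≤ = ⊔-lub (deg≤ zero) (deg-sumT (f ∘ suc) (deg≤ ∘ suc))

    deg-evalDualT : ∀ {r d} (h : Fin r → Mat n) t → (∀ l i j → deg (t l i j) ≤ d) →
                    deg (evalDualT h t) ≤ d
    deg-evalDualT h t deg≤ =
      deg-sumT _ λ l → deg-sumT _ λ i → deg-sumT _ λ j → deg≤ l i j

    deg-conjT : ∀ (M : Mat n) i j → deg (conjT M i j) ≤ 2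
    deg-conjT M i j = deg-sumT {n} _ λ p → deg-sumT {n} _ λ q → ≤-refl

    deg-conjT⊗ : ∀ (M : Mat n) i j {x} → deg x ≤ 1 → deg (conjT M i j ⊗ x) ≤ 3
    deg-conjT⊗ M i j deg-x≤1 = +-mono-≤ (deg-conjT M i j) deg-x≤1

    deg-SGen : ∀ {r} (A B : Fin r → Mat n) h → deg (SGen A B h) ≤ 2
    deg-SGen A B h = ⊔-lub (deg-evalDualT h _ λ l → deg-conjT (A l)) z≤n

  open Terms

  ≤1⇒≤3 : ∀ {d} → d ≤ 1 → d ≤ 3
  ≤1⇒≤3 d≤1 = ≤-trans d≤1 (s≤s z≤n)

  SGen⊗-∈-Closure3 : ∀ {n r} (A B : Fin r → Mat n) h {x} → deg x ≤ 1 →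
                     Closure3 (IsSGen A B) (SGen A B h ⊗ x)
  SGen⊗-∈-Closure3 A B h {x} deg-x≤1 =
    mul 2 (s≤s (s≤s z≤n)) (SGen A B h , deg-SGen A B h , reflT) (gen (h , reflT)) (x , deg-x≤1 , reflT)

  Closure3-sumT : ∀ {n m} {G : Term n → Set (c Level.⊔ ℓ)} (f : Fin m → Term n) →
                  (∀ i → Closure3 G (f i)) → Closure3 G (sumT f)
  Closure3-sumT {m = zero}  f f∈ = zeroCl
  Closure3-sumT {m = suc m} f f∈ = add (f∈ zero) (Closure3-sumT (f ∘ suc) (f∈ ∘ suc))

  module Linearity {n : ℕ} (φ : Functional n) where
    open SetoidReasoning setoid

    app-0# : app φ (cst 0#) ≈ 0#
    app-0# = begin
      app φ (cst 0#)           ≈⟨ resp φ z≤n z≤n (⊗-zeroˡ (cst 0#)) ⟨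
      app φ (cst 0# ⊗ cst 0#)  ≈⟨ homog φ 0# z≤n ⟩
      0# * app φ (cst 0#)      ≈⟨ zeroˡ _ ⟩
      0#                       ∎

    app-sumT : ∀ {m} (f : Fin m → Term n) → (∀ i → deg (f i) ≤ 3) →
               app φ (sumT f) ≈ sumK (λ i → app φ (f i))
    app-sumT {zero}  f deg≤3 = app-0#
    app-sumT {suc m} f deg≤3 =
      trans (additive φ (deg≤3 zero) (deg-sumT (f ∘ suc) (deg≤3 ∘ suc)))
            (+-congˡ (app-sumT (f ∘ suc) (deg≤3 ∘ suc)))

    app-evalDualT : ∀ {r} (h : Fin r → Mat n) t → (∀ l i j → deg (t l i j) ≤ 3) →
                    app φ (evalDualT h t) ≈ evalDual h (λ l i j → app φ (t l i j))
    app-evalDualT h t deg≤3 =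
      trans (app-sumT _ λ l → deg-sumT _ λ i → deg-sumT _ λ j → deg≤3 l i j) (sumK-cong λ l →
      trans (app-sumT _ λ i → deg-sumT _ λ j → deg≤3 l i j) (sumK-cong λ i →
      trans (app-sumT _ λ j → deg≤3 l i j) (sumK-cong λ j →
      homog φ (h l i j) (deg≤3 l i j))))

    app-SGen⊗ : ∀ {r} (A B : Fin r → Mat n) h {x} → deg x ≤ 1 →
                app φ (SGen A B h ⊗ x) ≈
                evalDual h (λ l i j → app φ (conjT (A l) i j ⊗ x)) + - (evalDual h B * app φ x)
    app-SGen⊗ {r} A B h {x} deg-x≤1 = begin
      app φ (SGen A B h ⊗ x)
        ≈⟨ resp φ (+-mono-≤ (deg-SGen A B h) deg-x≤1) (⊔-lub deg-conj⊗ (≤1⇒≤3 deg-x≤1))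
                  (transT (⊗-distribʳ-⊕ _ _ x) (⊕-cong (⊗-distribʳ-evalDualT h _ x) reflT)) ⟩
      app φ (evalDualT h conj⊗ ⊕ cst (- evalDual h B) ⊗ x)
        ≈⟨ additive φ deg-conj⊗ (≤1⇒≤3 deg-x≤1) ⟩
      app φ (evalDualT h conj⊗) + app φ (cst (- evalDual h B) ⊗ x)
        ≈⟨ +-cong (app-evalDualT h conj⊗ λ l i j → deg-conjT⊗ (A l) i j {x} deg-x≤1)
                  (homog φ (- evalDual h B) (≤1⇒≤3 deg-x≤1)) ⟩
      evalDual h (λ l i j → app φ (conj⊗ l i j)) + - evalDual h B * app φ x
        ≈⟨ +-congˡ (-‿distribˡ-* (evalDual h B) (app φ x)) ⟨
      evalDual h (λ l i j → app φ (conj⊗ l i j)) + - (evalDual h B * app φ x) ∎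
      where
      conj⊗ : Fin r → Fin n → Fin n → Term n
      conj⊗ l i j = conjT (A l) i j ⊗ x
      deg-conj⊗ : deg (evalDualT h conj⊗) ≤ 3
      deg-conj⊗ = deg-evalDualT h conj⊗ λ l i j → deg-conjT⊗ (A l) i j {x} deg-x≤1

  _⊗²_ : ∀ {n} → Term n × Term n → Term n × Term n → Term n × Term n
  (a , b) ⊗² (a' , b') = (a ⊗ a' , b ⊗ b')

  module ListSums where
    open SetoidReasoning setoid

    sumL-tabulate : ∀ {m} (f : Fin m → Carrier) → sumL (tabulate f) ≡ sumK f
    sumL-tabulate {zero}  f = P.refl
    sumL-tabulate {suc m} f = P.cong (f zero +_) (sumL-tabulate (f ∘ suc))

    sumL-map-allFin : ∀ {a m} {X : Set a} (F : X → Carrier) (h : Fin m → X) →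
                      sumL (map F (map h (allFin m))) ≡ sumK (F ∘ h)
    sumL-map-allFin F h = P.trans (P.cong (sumL ∘ map F) (map-tabulate (λ i → i) h))
                         (P.trans (P.cong sumL (map-tabulate h F)) (sumL-tabulate (F ∘ h)))

    sumL-map-++ : ∀ {a} {X : Set a} (F : X → Carrier) xs ys →
                  sumL (map F (xs ++ ys)) ≈ sumL (map F xs) + sumL (map F ys)
    sumL-map-++ F []       ys = sym (+-identityˡ _)
    sumL-map-++ F (x ∷ xs) ys = trans (+-congˡ (sumL-map-++ F xs ys)) (sym (+-assoc _ _ _))

    module _ {n} (F : Term n × Term n → Carrier) (F-⊗² : ∀ p q → F (p ⊗² q) ≈ F p * F q) where

      sumL-map-⊗²ˡ : ∀ p ys → sumL (map F (map (p ⊗²_) ys)) ≈ F p * sumL (map F ys)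
      sumL-map-⊗²ˡ p []       = sym (zeroʳ (F p))
      sumL-map-⊗²ˡ p (q ∷ ys) = begin
        F (p ⊗² q) + sumL (map F (map (p ⊗²_) ys)) ≈⟨ +-cong (F-⊗² p q) (sumL-map-⊗²ˡ p ys) ⟩
        F p * F q + F p * sumL (map F ys)           ≈⟨ distribˡ (F p) (F q) _ ⟨
        F p * (F q + sumL (map F ys))               ∎

      sumL-map-⊗² : ∀ xs ys → sumL (map F (concatMap (λ p → map (p ⊗²_) ys) xs)) ≈
                              sumL (map F xs) * sumL (map F ys)
      sumL-map-⊗² []       ys = sym (zeroˡ _)
      sumL-map-⊗² (p ∷ xs) ys = begin
        sumL (map F (map (p ⊗²_) ys ++ concatMap (λ p → map (p ⊗²_) ys) xs))
          ≈⟨ sumL-map-++ F (map (p ⊗²_) ys) _ ⟩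
        sumL (map F (map (p ⊗²_) ys)) + sumL (map F (concatMap (λ p → map (p ⊗²_) ys) xs))
          ≈⟨ +-cong (sumL-map-⊗²ˡ p ys) (sumL-map-⊗² xs ys) ⟩
        F p * sumL (map F ys) + sumL (map F xs) * sumL (map F ys)
          ≈⟨ distribʳ _ (F p) _ ⟨
        (F p + sumL (map F xs)) * sumL (map F ys) ∎

  open ListSums

  eval : ∀ {n} → Mat n → Mat n → Term n → Carrier
  eval X Y (cst a)  = a
  eval X Y (cv i j) = X i j
  eval X Y (dv i j) = Y i j
  eval X Y (s ⊕ t)  = eval X Y s + eval X Y t
  eval X Y (s ⊗ t)  = eval X Y s * eval X Y t

  module Evaluation {n : ℕ} where
    open SetoidReasoning setoid

    eval-sumT : ∀ {m} (X Y : Mat n) (f : Fin m → Term n) → eval X Y (sumT f) ≈ sumK (λ i → eval X Y (f i))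
    eval-sumT {zero}  X Y f = refl
    eval-sumT {suc m} X Y f = +-congˡ (eval-sumT X Y (f ∘ suc))

    eval-resp : ∀ {X Y : Mat n} → (Y ·M X) ≈M Iₙ → ∀ {s t} → s ≈T t → eval X Y s ≈ eval X Y t
    eval-resp YX≈I reflT                = refl
    eval-resp YX≈I (symT e)             = sym (eval-resp YX≈I e)
    eval-resp YX≈I (transT e e')        = trans (eval-resp YX≈I e) (eval-resp YX≈I e')
    eval-resp YX≈I (⊕-cong e e')        = +-cong (eval-resp YX≈I e) (eval-resp YX≈I e')
    eval-resp YX≈I (⊗-cong e e')        = *-cong (eval-resp YX≈I e) (eval-resp YX≈I e')
    eval-resp YX≈I (⊕-assoc x y z)      = +-assoc _ _ _
    eval-resp YX≈I (⊕-comm x y)         = +-comm _ _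
    eval-resp YX≈I (⊕-idˡ x)            = +-identityˡ _
    eval-resp YX≈I (⊕-invʳ x)           = trans (+-congˡ (-1*x≈-x _)) (-‿inverseʳ _)
    eval-resp YX≈I (⊗-assoc x y z)      = *-assoc _ _ _
    eval-resp YX≈I (⊗-comm x y)         = *-comm _ _
    eval-resp YX≈I (⊗-idˡ x)            = *-identityˡ _
    eval-resp YX≈I (⊗-distribˡ-⊕ x y z) = distribˡ _ _ _
    eval-resp YX≈I (cst-cong a≈b)       = a≈b
    eval-resp YX≈I (cst-+ a b)          = refl
    eval-resp YX≈I (cst-* a b)          = refl
    eval-resp {X} {Y} YX≈I (DC≡I i j)   = trans (eval-sumT {n} X Y _) (YX≈I i j)

    evaluation : (X Y : Mat n) → (Y ·M X) ≈M Iₙ → Functional n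
    evaluation X Y YX≈I = record
      { app      = eval X Y
      ; resp     = λ _ _ → eval-resp YX≈I
      ; additive = λ _ _ → refl
      ; homog    = λ _ _ → refl
      }

    eval-evalDualT : ∀ {r} (X Y : Mat n) (h : Fin r → Mat n) t →
                     eval X Y (evalDualT h t) ≈ evalDual h (λ l i j → eval X Y (t l i j))
    eval-evalDualT {r} X Y h t =
      trans (eval-sumT {r} X Y _) (sumK-cong λ l →
      trans (eval-sumT {n} X Y _) (sumK-cong λ i →
      eval-sumT {n} X Y λ j → cst (h l i j) ⊗ t l i j))

    eval-conjT : ∀ (X Y M : Mat n) i j → eval X Y (conjT M i j) ≈ ((X ·M M) ·M Y) i j
    eval-conjT X Y M i j = begin
      eval X Y (conjT M i j)
        ≈⟨ eval-sumT {n} X Y _ ⟩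
      sumK (λ p → eval X Y (sumT (λ q → cv i p ⊗ (cst (M p q) ⊗ dv q j))))
        ≈⟨ sumK-cong (λ p → trans (eval-sumT {n} X Y _)
                                  (sym (*-distribˡ-sumK (X i p) (λ q → M p q * Y q j)))) ⟩
      (X ·M (M ·M Y)) i j
        ≈⟨ ·M-assoc X M Y i j ⟨
      ((X ·M M) ·M Y) i j ∎

    module _ {r} {X Y : Mat n} (YX≈I : (Y ·M X) ≈M Iₙ) {A B : Fin r → Mat n}
             (XAY≈B : ∀ l → ((X ·M A l) ·M Y) ≈M B l) where

      eval-SGen : ∀ h → eval X Y (SGen A B h) ≈ 0#
      eval-SGen h = begin
        eval X Y (evalDualT h (λ l → conjT (A l))) + - evalDual h B
          ≈⟨ +-congʳ (eval-evalDualT X Y h (λ l → conjT (A l))) ⟩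
        evalDual h (λ l i j → eval X Y (conjT (A l) i j)) + - evalDual h B
          ≈⟨ +-congʳ (evalDual-cong h λ l i j → trans (eval-conjT X Y (A l) i j) (XAY≈B l i j)) ⟩
        evalDual h B + - evalDual h B
          ≈⟨ -‿inverseʳ _ ⟩
        0# ∎

      eval-Closure3 : ∀ {t} → Closure3 (IsSGen A B) t → eval X Y t ≈ 0#
      eval-Closure3 (gen (h , SGen≈t))   = trans (sym (eval-resp YX≈I SGen≈t)) (eval-SGen h)
      eval-Closure3 zeroCl               = refl
      eval-Closure3 (add s∈ t∈)          =
        trans (+-cong (eval-Closure3 s∈) (eval-Closure3 t∈)) (+-identityˡ 0#)
      eval-Closure3 (scale a t∈)         = trans (*-congˡ (eval-Closure3 t∈)) (zeroʳ a)
      eval-Closure3 (respCl s∈ s≈t)      = trans (sym (eval-resp YX≈I s≈t)) (eval-Closure3 s∈)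
      eval-Closure3 (mul _ _ _ s∈ _)     = trans (*-congʳ (eval-Closure3 s∈)) (zeroˡ _)

      evaluation-Hom3 : Hom3 A B (evaluation X Y YX≈I)
      evaluation-Hom3 t _ = eval-Closure3

    compose-evaluation : ∀ {X' Y' X Y : Mat n} (Y'X'≈I : (Y' ·M X') ≈M Iₙ) (YX≈I : (Y ·M X) ≈M Iₙ) t →
                         compose (evaluation X' Y' Y'X'≈I) (evaluation X Y YX≈I) t ≈
                         eval (X' ·M X) (Y ·M Y') t
    compose-evaluation {X'} {Y'} {X} {Y} _ _ = go
      where
      F : Term n × Term n → Carrier
      F (a , b) = eval X' Y' a * eval X Y b
      go : ∀ t → sumL (map F (Δ t)) ≈ eval (X' ·M X) (Y ·M Y') t
      go (cst a)  = trans (+-identityʳ _) (*-identityʳ a)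
      go (cv i j) = reflexive (sumL-map-allFin F (λ m → (cv i m , cv m j)))
      go (dv i j) = trans (reflexive (sumL-map-allFin F (λ m → (dv m j , dv i m))))
                          (sumK-cong λ m → *-comm (Y' m j) (Y i m))
      go (s ⊕ t)  = trans (sumL-map-++ F (Δ s) (Δ t)) (+-cong (go s) (go t))
      go (s ⊗ t)  = trans (sumL-map-⊗² F (λ p q → interchange _ _ _ _) (Δ s) (Δ t))
                          (*-cong (go s) (go t))

    eval-σₑ : ∀ {X Y : Mat n} → X ≈M Iₙ → Y ≈M Iₙ → ∀ t → eval X Y t ≈ σₑ t
    eval-σₑ X≈I Y≈I (cst a)  = refl
    eval-σₑ X≈I Y≈I (cv i j) = X≈I i j
    eval-σₑ X≈I Y≈I (dv i j) = Y≈I i j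
    eval-σₑ X≈I Y≈I (s ⊕ t)  = +-cong (eval-σₑ X≈I Y≈I s) (eval-σₑ X≈I Y≈I t)
    eval-σₑ X≈I Y≈I (s ⊗ t)  = *-cong (eval-σₑ X≈I Y≈I s) (eval-σₑ X≈I Y≈I t)

  open Evaluation

  sameOrbit⇒isoC3 : ∀ {n r} {A B : Fin r → Mat n} → SameOrbit n r A B → IsoC3 n r A B
  sameOrbit⇒isoC3 {A = A} {B} (g , g' , gg'≈I , g'g≈I , gAg'≈B) =
    evaluation g g' g'g≈I , evaluation g' g gg'≈I ,
    evaluation-Hom3 g'g≈I gAg'≈B ,
    evaluation-Hom3 gg'≈I g'Bg≈A ,
    (λ t _ → trans (compose-evaluation gg'≈I g'g≈I t) (eval-σₑ g'g≈I g'g≈I t)) ,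
    (λ t _ → trans (compose-evaluation g'g≈I gg'≈I t) (eval-σₑ gg'≈I gg'≈I t))
    where
    g'Bg≈A : ∀ l → ((g' ·M B l) ·M g) ≈M A l
    g'Bg≈A = λ l → intertwining⇒conjugate g'g≈I (conjugate⇒intertwining g'g≈I (gAg'≈B l))

  coordinates : ∀ {n} → Functional n → Mat n
  coordinates φ i j = app φ (cv i j)

  module Coordinates {n : ℕ} (φ : Functional n) where
    open SetoidReasoning setoid
    open Linearity φ

    g : Mat n
    g = coordinates φ

    app-conjT⊗cv : ∀ (M : Mat n) i k → sumK (λ j → app φ (conjT M i j ⊗ cv j k)) ≈ (g ·M M) i k
    app-conjT⊗cv M i k = begin
      sumK (λ j → app φ (conjT M i j ⊗ cv j k))
        ≈⟨ sumK-cong expand ⟩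
      sumK (λ j → sumK (λ p → sumK (λ q → M p q * E p q j)))
        ≈⟨ trans (sumK-comm (λ j p → sumK (λ q → M p q * E p q j)))
                 (sumK-cong λ p → sumK-comm (λ j q → M p q * E p q j)) ⟩
      sumK (λ p → sumK (λ q → sumK (λ j → M p q * E p q j)))
        ≈⟨ sumK-cong (λ p → sumK-cong λ q →
             trans (sym (*-distribˡ-sumK (M p q) (E p q))) (*-congˡ (sumK-E p q))) ⟩
      sumK (λ p → sumK (λ q → M p q * (δ q k * g i p)))
        ≈⟨ sumK-cong (λ p → trans (sumK-cong λ q → x∙yz≈zx∙y (M p q) (δ q k) (g i p))
                                   (sumK-*δ k (λ q → g i p * M p q))) ⟩
      (g ·M M) i k ∎
      where
      E : Fin n → Fin n → Fin n → Carrier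
      E p q j = app φ (cv i p ⊗ (dv q j ⊗ cv j k))

      rearrange : ∀ (x a d y : Term n) → (x ⊗ (a ⊗ d)) ⊗ y ≈T a ⊗ (x ⊗ (d ⊗ y))
      rearrange x a d y =
        transT (⊗-assoc x (a ⊗ d) y) (transT (⊗-cong reflT (⊗-assoc a d y))
        (transT (symT (⊗-assoc x a (d ⊗ y)))
        (transT (⊗-cong (⊗-comm x a) reflT) (⊗-assoc a x (d ⊗ y)))))

      expand : ∀ j → app φ (conjT M i j ⊗ cv j k) ≈ sumK (λ p → sumK (λ q → M p q * E p q j))
      expand j = begin
        app φ (conjT M i j ⊗ cv j k)
          ≈⟨ resp φ (deg-conjT⊗ M i j {cv j k} ≤-refl)
                    (deg-sumT {m = n} _ λ p → deg-sumT {m = n} _ λ q → ≤-refl)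
                    (transT (⊗-distribʳ-sumT {m = n} _ (cv j k)) (sumT-cong λ p →
                     transT (⊗-distribʳ-sumT {m = n} _ (cv j k)) (sumT-cong λ q →
                     rearrange (cv i p) (cst (M p q)) (dv q j) (cv j k)))) ⟩
        app φ (sumT (λ p → sumT (λ q → cst (M p q) ⊗ (cv i p ⊗ (dv q j ⊗ cv j k)))))
          ≈⟨ trans (app-sumT {n} _ λ p → deg-sumT {m = n} _ λ q → ≤-refl) (sumK-cong λ p →
             trans (app-sumT {n} _ λ q → ≤-refl) (sumK-cong λ q →
             homog φ (M p q) ≤-refl)) ⟩
        sumK (λ p → sumK (λ q → M p q * E p q j)) ∎

      -- This is where the relation DC = I of k[G] is used.
      sumK-E : ∀ p q → sumK (E p q) ≈ δ q k * g i p
      sumK-E p q = begin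
        sumK (E p q)
          ≈⟨ app-sumT {n} _ (λ j → ≤-refl) ⟨
        app φ (sumT (λ j → cv i p ⊗ (dv q j ⊗ cv j k)))
          ≈⟨ resp φ (deg-sumT {m = n} _ λ j → ≤-refl) (s≤s z≤n)
                    (transT (symT (⊗-distribˡ-sumT {m = n} _ (cv i p)))
                    (transT (⊗-cong reflT (DC≡I q k)) (⊗-comm (cv i p) (cst (δ q k))))) ⟩
        app φ (cst (δ q k) ⊗ cv i p)
          ≈⟨ homog φ (δ q k) (s≤s z≤n) ⟩
        δ q k * g i p ∎

    Hom3⇒intertwining : ∀ {r} {A B : Fin r → Mat n} → Hom3 A B φ → ∀ l → (g ·M A l) ≈M (B l ·M g)
    Hom3⇒intertwining {A = A} {B} hom l i k = x∙y⁻¹≈ε⇒x≈y _ _ (begin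
      (g ·M A l) i k + - (B l ·M g) i k
        ≈⟨ +-cong (app-conjT⊗cv (A l) i k) (sym (-‿distrib-sumK (λ j → B l i j * g j k))) ⟨
      sumK (λ j → app φ (conjT (A l) i j ⊗ cv j k)) + sumK (λ j → - (B l i j * g j k))
        ≈⟨ sumK-+ {n} _ _ ⟨
      sumK (λ j → app φ (conjT (A l) i j ⊗ cv j k) + - (B l i j * g j k))
        ≈⟨ sumK-cong app-Sⱼ ⟨
      sumK (λ j → app φ (Sⱼ j))
        ≈⟨ app-sumT Sⱼ deg-Sⱼ ⟨
      app φ (sumT Sⱼ)
        ≈⟨ hom (sumT Sⱼ) (deg-sumT Sⱼ deg-Sⱼ)
               (Closure3-sumT Sⱼ λ j → SGen⊗-∈-Closure3 A B (indicator l i j) ≤-refl) ⟩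
      0# ∎)
      where
      Sⱼ : Fin n → Term n
      Sⱼ j = SGen A B (indicator l i j) ⊗ cv j k
      deg-Sⱼ : ∀ j → deg (Sⱼ j) ≤ 3
      deg-Sⱼ j = +-mono-≤ (deg-SGen A B (indicator l i j)) (≤-refl {1})
      app-Sⱼ : ∀ j → app φ (Sⱼ j) ≈ app φ (conjT (A l) i j ⊗ cv j k) + - (B l i j * g j k)
      app-Sⱼ j = trans (app-SGen⊗ A B (indicator l i j) ≤-refl)
                       (+-cong (evalDual-indicator l i j _) (-‿cong (*-congʳ (evalDual-indicator l i j B))))

  compose-cv : ∀ {n} (ψ φ : Functional n) i j →
               compose ψ φ (cv i j) ≈ (coordinates ψ ·M coordinates φ) i j
  compose-cv ψ φ i j = reflexive (sumL-map-allFin _ (λ m → (cv i m , cv m j)))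

  isoC3⇒sameOrbit : ∀ {n r} {A B : Fin r → Mat n} → IsoC3 n r A B → SameOrbit n r A B
  isoC3⇒sameOrbit (φ , ψ , hom-φ , _ , ψφ≈σₑ , φψ≈σₑ) =
    g , g' , gg'≈I , g'g≈I , λ l → intertwining⇒conjugate gg'≈I (Hom3⇒intertwining hom-φ l)
    where
    open Coordinates φ
    g' : Mat _
    g' = coordinates ψ
    gg'≈I : (g ·M g') ≈M Iₙ
    gg'≈I i j = trans (sym (compose-cv φ ψ i j)) (φψ≈σₑ (cv i j) (s≤s z≤n))
    g'g≈I : (g' ·M g) ≈M Iₙ
    g'g≈I i j = trans (sym (compose-cv ψ φ i j)) (ψφ≈σₑ (cv i j) (s≤s z≤n))

corollary4p7 : ∀ {c ℓ : Level} (K : Field c ℓ) (n r : ℕ)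
    (A B : Fin r → FieldDefs.Mat K n) →
    FieldDefs.SameOrbit K n r A B ⇔ FieldDefs.IsoC3 K n r A B
corollary4p7 K n r A B = mk⇔ (sameOrbit⇒isoC3 K) (isoC3⇒sameOrbit K)
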